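{- For each $v\in\{13,14,15,16\}$ there exists a $3$-way $6$-homogeneous $(v,3,2)$ Steiner trade of volume $2v$.
   Context: Let $V$ be a finite set with $v$ elements and let $t<k<v$ be positive integers. A $\mu$-way $(v,k,t)$ trade $T=\{T_1,\dots,T_\mu\}$ of volume $m$ consists of $\mu$ pairwise disjoint collections $T_1,\dots,T_\mu$, each of $m$ blocks ($k$-subsets of $V$), such that every $t$-subset of $V$ is contained in the same number of blocks in each $T_i$. The foundation $\mathrm{found}(T)$ is the set of elements covered by the blocks. It is a Steiner trade if every $t$-subset of $\mathrm{found}(T)$ is in at most one block of each $T_i$, and $d$-homogeneous if every element of $V$ lies in exactly $d$ blocks of each $T_i$. -}

module Defs where

open import Data.Nat using (ℕ; _≤_)
open import Data.Fin using (Fin)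
open import Data.Fin.Subset using (Subset; _∈_; _∉_; _⊆_; ∣_∣)
open import Data.Fin.Subset.Properties using (_⊆?_; _∈?_)
open import Data.List using (List; length; filter)
open import Data.List.Relation.Unary.All using (All)
open import Data.List.Relation.Unary.Unique.Propositional using (Unique)
import Data.List.Membership.Propositional as LM
open import Data.Product using (_×_; ∃; ∃-syntax)
open import Relation.Binary.PropositionalEquality using (_≡_; _≢_)

-- The point set V is Fin v; a block is a subset of V (required to have
-- exactly k elements); a collection T_i of blocks is a duplicate-free list.

count : ∀ {v} → Subset v → List (Subset v) → ℕ
count S C = length (filter (λ B → S ⊆? B) C)

degree : ∀ {v} → Fin v → List (Subset v) → ℕ
degree x C = length (filter (λ B → x ∈? B) C)

InFound : ∀ {μ v} → (Fin μ → List (Subset v)) → Fin v → Set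
InFound {μ} T x = ∃[ i ] ∃[ B ] (B LM.∈ T i × x ∈ B)

record IsTrade (μ v k t m : ℕ) (T : Fin μ → List (Subset v)) : Set where
  field
    volume    : ∀ i → length (T i) ≡ m
    distinct  : ∀ i → Unique (T i)
    blockSize : ∀ i → All (λ B → ∣ B ∣ ≡ k) (T i)
    disjoint  : ∀ i j → i ≢ j → ∀ B → B LM.∈ T i → B LM.∉ T j
    balanced  : ∀ (S : Subset v) → ∣ S ∣ ≡ t → ∀ i j → count S (T i) ≡ count S (T j)

IsSteiner : ∀ {μ v} (t : ℕ) → (Fin μ → List (Subset v)) → Set
IsSteiner {μ} {v} t T =
  ∀ (S : Subset v) → ∣ S ∣ ≡ t → (∀ x → x ∈ S → InFound T x) → ∀ i → count S (T i) ≤ 1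

IsHomogeneous : ∀ {μ v} (d : ℕ) → (Fin μ → List (Subset v)) → Set
IsHomogeneous {μ} {v} d T = ∀ (x : Fin v) → ∀ i → degree x (T i) ≡ d

module Submission where

-- Each of the four trades is exhibited explicitly.  Every defining property
-- of a trade, including the Steiner and homogeneity conditions, is decidable,
-- because the t-subsets of V can be listed exhaustively; so each example is
-- certified by evaluating these decision procedures.

open import Defs
open import Data.Bool using (_∨_)
import Data.Bool.Properties as Bool
open import Data.Fin using (Fin; zero; suc; toℕ)
import Data.Fin.Properties as Fin
open import Data.Fin.Subset using (Subset; inside; outside; ∣_∣)
open import Data.Fin.Subset.Properties using (_∈?_)
open import Data.List using (List; []; _∷_; [_]; _++_; map; length)
open import Data.List.Relation.Unary.All as All using (All)
open import Data.List.Relation.Unary.Any as Any using (here)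
open import Data.List.Relation.Unary.Any.Properties using (++⁺ˡ; ++⁺ʳ; map⁺)
import Data.List.Relation.Unary.Unique.DecPropositional as Unique
open import Data.List.Membership.Propositional using (find; lose)
import Data.List.Membership.Propositional as List
open import Data.Nat using (ℕ; zero; suc; _≤_; _*_; _+_; _∸_; _≡ᵇ_; _≟_; _≤?_; s≤s)
open import Data.Nat.Properties using (m+[n∸m]≡n; ∸-monoˡ-≤)
open import Data.Product using (_×_; ∃-syntax; _,_)
open import Data.Vec using ([]; _∷_; tabulate)
open import Data.Vec.Properties using (≡-dec)
open import Relation.Binary.PropositionalEquality using (_≡_; refl; sym; trans; cong; subst)
open import Relation.Nullary using (Dec; yes; ¬?; _×-dec_; _→-dec_)
open import Relation.Nullary.Decidable using (map′; True; toWitness)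
open import Relation.Unary using (Pred; Decidable)
open import Relation.Binary.Definitions using (DecidableEquality)

subsetsOfSize : ∀ n → ℕ → List (Subset n)
subsetsOfSize zero    zero    = [ [] ]
subsetsOfSize zero    (suc k) = []
subsetsOfSize (suc n) k       = containingZero k ++ map (outside ∷_) (subsetsOfSize n k)
  where
  containingZero : ℕ → List (Subset (suc n))
  containingZero zero    = []
  containingZero (suc k) = map (inside ∷_) (subsetsOfSize n k)

∈-subsetsOfSize : ∀ {n} (S : Subset n) → S List.∈ subsetsOfSize n ∣ S ∣
∈-subsetsOfSize []            = here refl
∈-subsetsOfSize (inside ∷ S)  = ++⁺ˡ (map⁺ (Any.map (cong (inside ∷_)) (∈-subsetsOfSize S)))
∈-subsetsOfSize (outside ∷ S) = ++⁺ʳ _ (map⁺ (Any.map (cong (outside ∷_)) (∈-subsetsOfSize S)))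

module _ {n p} {P : Pred (Subset n) p} (P? : Decidable P) where

  ∀-ofSize? : ∀ k → Dec (∀ S → ∣ S ∣ ≡ k → P S)
  ∀-ofSize? k = map′ fromAll (λ ∀P → All.tabulate λ {S} _ → ∀P S)
    -- Re-testing the size spares proving that subsetsOfSize n k has only k-subsets.
    (All.all? (λ S → ∣ S ∣ ≟ k →-dec P? S) (subsetsOfSize n k))
    where
    fromAll : All (λ S → ∣ S ∣ ≡ k → P S) (subsetsOfSize n k) → ∀ S → ∣ S ∣ ≡ k → P S
    fromAll all S ∣S∣≡k =
      All.lookup all (subst (λ k → S List.∈ subsetsOfSize n k) ∣S∣≡k (∈-subsetsOfSize S)) ∣S∣≡k

module _ {a p} {A : Set a} {P : Pred A p} (P? : Decidable P) where

  ∀∈? : ∀ xs → Dec (∀ x → x List.∈ xs → P x)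
  ∀∈? xs = map′ (λ all x → All.lookup all) (λ ∀P → All.tabulate (∀P _)) (All.all? P? xs)

  ∃∈? : ∀ xs → Dec (∃[ x ] (x List.∈ xs × P x))
  ∃∈? xs = map′ find (λ (x , x∈xs , Px) → lose x∈xs Px) (Any.any? P? xs)

allEqual? : ∀ {n} (f : Fin n → ℕ) → Dec (∀ i j → f i ≡ f j)
allEqual? {zero}  f = yes λ ()
allEqual? {suc n} f = map′
  (λ ≡f₀ i j → trans (≡f₀ i) (sym (≡f₀ j)))
  (λ eq i → eq i zero)
  (Fin.all? λ i → f i ≟ f zero)

_≟ˢ_ : ∀ {n} → DecidableEquality (Subset n)
_≟ˢ_ = ≡-dec Bool._≟_

module _ {μ v : ℕ} (T : Fin μ → List (Subset v)) where

  isTrade? : ∀ k t m → Dec (IsTrade μ v k t m T)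
  isTrade? k t m = map′
    (λ (vol , dst , size , dsj , bal) → record
      { volume = vol ; distinct = dst ; blockSize = size ; disjoint = dsj ; balanced = bal })
    (λ tr → let open IsTrade tr in volume , distinct , blockSize , disjoint , balanced)
    (   Fin.all? (λ i → length (T i) ≟ m)
    ×-dec Fin.all? (λ i → Unique.unique? _≟ˢ_ (T i))
    ×-dec Fin.all? (λ i → All.all? (λ B → ∣ B ∣ ≟ k) (T i))
    ×-dec Fin.all? (λ i → Fin.all? λ j → ¬? (i Fin.≟ j) →-dec ∀∈? (λ B → ¬? (Any.any? (B ≟ˢ_) (T j))) (T i))
    ×-dec ∀-ofSize? (λ S → allEqual? λ i → count S (T i)) t)

  inFound? : ∀ x → Dec (InFound T x)
  inFound? x = Fin.any? λ i → ∃∈? (x ∈?_) (T i)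

  isSteiner? : ∀ t → Dec (IsSteiner t T)
  isSteiner? = ∀-ofSize? λ S →
    Fin.all? (λ x → x ∈? S →-dec inFound? x) →-dec Fin.all? λ i → count S (T i) ≤? 1

  isHomogeneous? : ∀ d → Dec (IsHomogeneous d T)
  isHomogeneous? d = Fin.all? λ x → Fin.all? λ i → degree x (T i) ≟ d

HomogeneousSteinerTrade : (μ v k t m d : ℕ) → Set
HomogeneousSteinerTrade μ v k t m d =
  ∃[ T ] (IsTrade μ v k t m T × IsSteiner t T × IsHomogeneous d T)

certify : ∀ {μ v} k t m d (T : Fin μ → List (Subset v)) →
          True (isTrade? T k t m ×-dec isSteiner? T t ×-dec isHomogeneous? T d) →
          HomogeneousSteinerTrade μ v k t m d
certify k t m d T ok = T , toWitness ok

-- The block {a, b, c} of Fin n; an index ≥ n is silently dropped.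
triple : ∀ {n} → ℕ → ℕ → ℕ → Subset n
triple a b c = tabulate λ i → (toℕ i ≡ᵇ a) ∨ (toℕ i ≡ᵇ b) ∨ (toℕ i ≡ᵇ c)

T13 : Fin 3 → List (Subset 13)
T13 zero =
  triple 0 1 8 ∷ triple 0 2 11 ∷ triple 0 3 6 ∷ triple 0 4 12 ∷ triple 0 5 9 ∷ triple 0 7 10 ∷
  triple 1 2 6 ∷ triple 1 3 7 ∷ triple 1 4 5 ∷ triple 1 9 12 ∷ triple 1 10 11 ∷ triple 2 3 8 ∷
  triple 2 4 7 ∷ triple 2 5 12 ∷ triple 2 9 10 ∷ triple 3 4 9 ∷ triple 3 5 11 ∷ triple 3 10 12 ∷
  triple 4 6 11 ∷ triple 4 8 10 ∷ triple 5 6 10 ∷ triple 5 7 8 ∷ triple 6 7 12 ∷ triple 6 8 9 ∷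
  triple 7 9 11 ∷ triple 8 11 12 ∷ []
T13 (suc zero) =
  triple 0 1 4 ∷ triple 0 2 7 ∷ triple 0 3 9 ∷ triple 0 5 11 ∷ triple 0 6 10 ∷ triple 0 8 12 ∷
  triple 1 2 10 ∷ triple 1 3 12 ∷ triple 1 5 8 ∷ triple 1 6 7 ∷ triple 1 9 11 ∷ triple 2 3 11 ∷
  triple 2 4 8 ∷ triple 2 5 6 ∷ triple 2 9 12 ∷ triple 3 4 5 ∷ triple 3 6 8 ∷ triple 3 7 10 ∷
  triple 4 6 9 ∷ triple 4 7 12 ∷ triple 4 10 11 ∷ triple 5 7 9 ∷ triple 5 10 12 ∷ triple 6 11 12 ∷
  triple 7 8 11 ∷ triple 8 9 10 ∷ []
T13 (suc (suc zero)) =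
  triple 0 1 12 ∷ triple 0 2 3 ∷ triple 0 4 8 ∷ triple 0 5 10 ∷ triple 0 6 11 ∷ triple 0 7 9 ∷
  triple 1 2 4 ∷ triple 1 3 5 ∷ triple 1 6 9 ∷ triple 1 7 11 ∷ triple 1 8 10 ∷ triple 2 5 9 ∷
  triple 2 6 8 ∷ triple 2 7 12 ∷ triple 2 10 11 ∷ triple 3 4 6 ∷ triple 3 7 8 ∷ triple 3 9 10 ∷
  triple 3 11 12 ∷ triple 4 5 7 ∷ triple 4 9 11 ∷ triple 4 10 12 ∷ triple 5 6 12 ∷ triple 5 8 11 ∷
  triple 6 7 10 ∷ triple 8 9 12 ∷ []

T14 : Fin 3 → List (Subset 14)
T14 zero =
  triple 0 1 2 ∷ triple 0 3 8 ∷ triple 0 4 6 ∷ triple 0 5 10 ∷ triple 0 9 11 ∷ triple 0 12 13 ∷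
  triple 1 3 13 ∷ triple 1 4 7 ∷ triple 1 5 11 ∷ triple 1 6 10 ∷ triple 1 9 12 ∷ triple 2 3 12 ∷
  triple 2 4 8 ∷ triple 2 5 13 ∷ triple 2 6 11 ∷ triple 2 7 10 ∷ triple 3 4 5 ∷ triple 3 6 9 ∷
  triple 3 7 11 ∷ triple 4 9 13 ∷ triple 4 10 12 ∷ triple 5 6 8 ∷ triple 5 7 9 ∷ triple 6 7 12 ∷
  triple 7 8 13 ∷ triple 8 9 10 ∷ triple 8 11 12 ∷ triple 10 11 13 ∷ []
T14 (suc zero) =
  triple 0 1 13 ∷ triple 0 2 10 ∷ triple 0 3 6 ∷ triple 0 4 5 ∷ triple 0 8 9 ∷ triple 0 11 12 ∷
  triple 1 2 5 ∷ triple 1 3 9 ∷ triple 1 4 6 ∷ triple 1 7 12 ∷ triple 1 10 11 ∷ triple 2 3 11 ∷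
  triple 2 4 13 ∷ triple 2 6 7 ∷ triple 2 8 12 ∷ triple 3 4 12 ∷ triple 3 5 8 ∷ triple 3 7 13 ∷
  triple 4 7 8 ∷ triple 4 9 10 ∷ triple 5 6 9 ∷ triple 5 7 10 ∷ triple 5 11 13 ∷ triple 6 8 11 ∷
  triple 6 10 12 ∷ triple 7 9 11 ∷ triple 8 10 13 ∷ triple 9 12 13 ∷ []
T14 (suc (suc zero)) =
  triple 0 1 3 ∷ triple 0 2 12 ∷ triple 0 4 9 ∷ triple 0 5 13 ∷ triple 0 6 10 ∷ triple 0 8 11 ∷
  triple 1 2 7 ∷ triple 1 4 10 ∷ triple 1 5 6 ∷ triple 1 9 13 ∷ triple 1 11 12 ∷ triple 2 3 4 ∷
  triple 2 5 10 ∷ triple 2 6 8 ∷ triple 2 11 13 ∷ triple 3 5 9 ∷ triple 3 6 11 ∷ triple 3 7 12 ∷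
  triple 3 8 13 ∷ triple 4 5 8 ∷ triple 4 6 7 ∷ triple 4 12 13 ∷ triple 5 7 11 ∷ triple 6 9 12 ∷
  triple 7 8 9 ∷ triple 7 10 13 ∷ triple 8 10 12 ∷ triple 9 10 11 ∷ []

T15 : Fin 3 → List (Subset 15)
T15 zero =
  triple 0 1 12 ∷ triple 0 3 10 ∷ triple 0 4 14 ∷ triple 0 5 11 ∷ triple 0 6 9 ∷ triple 0 7 8 ∷
  triple 1 2 13 ∷ triple 1 4 7 ∷ triple 1 5 10 ∷ triple 1 6 11 ∷ triple 1 8 9 ∷ triple 2 3 6 ∷
  triple 2 5 14 ∷ triple 2 7 10 ∷ triple 2 8 11 ∷ triple 2 9 12 ∷ triple 3 4 8 ∷ triple 3 7 13 ∷
  triple 3 9 14 ∷ triple 3 11 12 ∷ triple 4 5 9 ∷ triple 4 10 11 ∷ triple 4 12 13 ∷ triple 5 6 13 ∷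
  triple 5 8 12 ∷ triple 6 7 12 ∷ triple 6 10 14 ∷ triple 7 11 14 ∷ triple 8 13 14 ∷ triple 9 10 13 ∷ []
T15 (suc zero) =
  triple 0 1 6 ∷ triple 0 3 8 ∷ triple 0 4 9 ∷ triple 0 5 10 ∷ triple 0 7 12 ∷ triple 0 11 14 ∷
  triple 1 2 10 ∷ triple 1 4 8 ∷ triple 1 5 13 ∷ triple 1 7 11 ∷ triple 1 9 12 ∷ triple 2 3 12 ∷
  triple 2 5 11 ∷ triple 2 6 7 ∷ triple 2 8 9 ∷ triple 2 13 14 ∷ triple 3 4 11 ∷ triple 3 6 14 ∷
  triple 3 7 10 ∷ triple 3 9 13 ∷ triple 4 5 12 ∷ triple 4 7 14 ∷ triple 4 10 13 ∷ triple 5 6 9 ∷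
  triple 5 8 14 ∷ triple 6 10 11 ∷ triple 6 12 13 ∷ triple 7 8 13 ∷ triple 8 11 12 ∷ triple 9 10 14 ∷ []
T15 (suc (suc zero)) =
  triple 0 1 7 ∷ triple 0 3 12 ∷ triple 0 4 11 ∷ triple 0 5 9 ∷ triple 0 6 10 ∷ triple 0 8 14 ∷
  triple 1 2 5 ∷ triple 1 4 12 ∷ triple 1 6 13 ∷ triple 1 8 11 ∷ triple 1 9 10 ∷ triple 2 3 8 ∷
  triple 2 6 12 ∷ triple 2 7 13 ∷ triple 2 9 14 ∷ triple 2 10 11 ∷ triple 3 4 7 ∷ triple 3 6 9 ∷
  triple 3 10 13 ∷ triple 3 11 14 ∷ triple 4 5 10 ∷ triple 4 8 9 ∷ triple 4 13 14 ∷ triple 5 6 14 ∷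
  triple 5 8 13 ∷ triple 5 11 12 ∷ triple 6 7 11 ∷ triple 7 8 12 ∷ triple 7 10 14 ∷ triple 9 12 13 ∷ []

T16 : Fin 3 → List (Subset 16)
T16 zero =
  triple 0 1 4 ∷ triple 0 2 11 ∷ triple 0 3 15 ∷ triple 0 5 12 ∷ triple 0 7 14 ∷ triple 0 9 13 ∷
  triple 1 2 3 ∷ triple 1 5 8 ∷ triple 1 6 10 ∷ triple 1 12 15 ∷ triple 1 13 14 ∷ triple 2 4 15 ∷
  triple 2 5 7 ∷ triple 2 6 13 ∷ triple 2 9 14 ∷ triple 3 4 7 ∷ triple 3 5 6 ∷ triple 3 8 10 ∷
  triple 3 12 14 ∷ triple 4 5 9 ∷ triple 4 6 11 ∷ triple 4 8 13 ∷ triple 5 10 14 ∷ triple 6 7 9 ∷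
  triple 6 8 15 ∷ triple 7 8 12 ∷ triple 7 10 11 ∷ triple 8 9 11 ∷ triple 9 10 12 ∷ triple 10 13 15 ∷
  triple 11 12 13 ∷ triple 11 14 15 ∷ []
T16 (suc zero) =
  triple 0 1 12 ∷ triple 0 2 7 ∷ triple 0 3 4 ∷ triple 0 5 9 ∷ triple 0 11 15 ∷ triple 0 13 14 ∷
  triple 1 2 15 ∷ triple 1 3 8 ∷ triple 1 4 13 ∷ triple 1 5 6 ∷ triple 1 10 14 ∷ triple 2 3 6 ∷
  triple 2 4 5 ∷ triple 2 9 13 ∷ triple 2 11 14 ∷ triple 3 5 14 ∷ triple 3 7 12 ∷ triple 3 10 15 ∷
  triple 4 6 9 ∷ triple 4 7 11 ∷ triple 4 8 15 ∷ triple 5 7 10 ∷ triple 5 8 12 ∷ triple 6 7 8 ∷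
  triple 6 10 11 ∷ triple 6 13 15 ∷ triple 7 9 14 ∷ triple 8 9 10 ∷ triple 8 11 13 ∷ triple 9 11 12 ∷
  triple 10 12 13 ∷ triple 12 14 15 ∷ []
T16 (suc (suc zero)) =
  triple 0 1 2 ∷ triple 0 3 12 ∷ triple 0 4 9 ∷ triple 0 5 7 ∷ triple 0 11 14 ∷ triple 0 13 15 ∷
  triple 1 3 6 ∷ triple 1 4 5 ∷ triple 1 8 12 ∷ triple 1 10 13 ∷ triple 1 14 15 ∷ triple 2 3 4 ∷
  triple 2 5 14 ∷ triple 2 6 15 ∷ triple 2 7 9 ∷ triple 2 11 13 ∷ triple 3 5 10 ∷ triple 3 7 14 ∷
  triple 3 8 15 ∷ triple 4 6 13 ∷ triple 4 7 8 ∷ triple 4 11 15 ∷ triple 5 6 8 ∷ triple 5 9 12 ∷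
  triple 6 7 10 ∷ triple 6 9 11 ∷ triple 7 11 12 ∷ triple 8 9 13 ∷ triple 8 10 11 ∷ triple 9 10 14 ∷
  triple 10 12 15 ∷ triple 12 13 14 ∷ []

trade : ∀ n → n ≤ 3 → HomogeneousSteinerTrade 3 (13 + n) 3 2 (2 * (13 + n)) 6
trade 0 _ = certify 3 2 26 6 T13 _
trade 1 _ = certify 3 2 28 6 T14 _
trade 2 _ = certify 3 2 30 6 T15 _
trade 3 _ = certify 3 2 32 6 T16 _
trade (suc (suc (suc (suc _)))) (s≤s (s≤s (s≤s ())))

proposition3p5 : ∀ (v : ℕ) → 13 ≤ v → v ≤ 16 →
    ∃[ T ] (IsTrade 3 v 3 2 (2 * v) T × IsSteiner 2 T × IsHomogeneous 6 T)
proposition3p5 v 13≤v v≤16 =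
  subst (λ v → HomogeneousSteinerTrade 3 v 3 2 (2 * v) 6) (m+[n∸m]≡n 13≤v) (trade (v ∸ 13) (∸-monoˡ-≤ 13 v≤16))
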